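{- Let $k,\ell$ be positive integers with $\ell\geq k$, let $\lambda\in\mathcal{P}_{\rm sq}^k$ and let $\mu\in\mathcal{P}^\ell$, regarded as a weakly decreasing function $\mu:[\ell]\to[\ell]$. Then $\mu\in\mathcal{P}^\ell(\lambda)$ if and only if there exists $b\in[\ell-k+1]$ such that: (i) $\mu(b)=b+k-1$ and $\mu(b+k-1)=b$; (ii) for all $i$ with $1\leq i<b$, $\mu(\mu(i))>i$; (iii) for all $i$ with $b+k-1<i\leq \ell$, $\mu(\mu(i))<i$; (iv) the function $\tilde\lambda:[k]\to\mathbb{Z}$ defined by $\tilde\lambda(i)=\mu(b+i-1)-b+1$ for $1\leq i\leq k$ satisfies $\tilde\lambda\in\{\lambda,\tau_k(\lambda)\}$.
   Context: $[n]=\{1,\dots,n\}$. A partition with $n$ parts is a sequence $(\lambda_1,\dots,\lambda_n)$ of positive integers with $\lambda_1\geq\dots\geq\lambda_n>0$; it is identified with the weakly decreasing function $[n]\to\mathbb{Z}^+$, $i\mapsto\lambda_i=\lambda(i)$. $\mathcal{P}^{n,k}$ is the set of partitions with exactly $n$ parts and $\lambda_1\leq k$; $\mathcal{P}^k=\mathcal{P}^{k,k}$. The map $\tau_k:\mathcal{P}^{n,k}\to\mathcal{P}^{n,k}$ is $\tau_k(\lambda_1,\dots,\lambda_n)=(k+1-\lambda_n,\dots,k+1-\lambda_1)$. $\mathcal{P}_{\rm sq}^k=\{\lambda\in\mathcal{P}^k:\lambda_1=k,\ \lambda_k=1\}$. For $\lambda=(\lambda_1,\dots,\lambda_n)$,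 $\lambda\setminus\{\lambda_n\}=(\lambda_1,\dots,\lambda_{n-1})$. For $\lambda\in\mathcal{P}^k$ and $\ell\geq k$, sets $\mathcal{P}^\ell(\lambda)\subseteq\mathcal{P}^\ell$ are defined inductively: $\mathcal{P}^k(\lambda)=\{\lambda,\tau_k(\lambda)\}$, and for $\ell>k$, $\mathcal{P}^\ell_{\rm d}(\lambda)=\{\mu\in\mathcal{P}^\ell:\mu\setminus\{\mu_\ell\}\in\mathcal{P}^{\ell-1}(\lambda)\}$ and $\mathcal{P}^\ell(\lambda)=\mathcal{P}^\ell_{\rm d}(\lambda)\cup\tau_\ell(\mathcal{P}^\ell_{\rm d}(\lambda))$. -}

module Defs where

open import Data.Nat using (ℕ; zero; suc; _+_; _∸_; _≤_; _<_; _≥_; _>_)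
open import Data.List using (List; []; _∷_; length; map; reverse; applyUpTo)
open import Data.List.Relation.Unary.All using (All)
open import Data.List.Relation.Unary.Linked using (Linked)
open import Data.Integer as ℤ using (ℤ; +_)
open import Data.Product using (Σ; _×_; ∃-syntax)
open import Data.Sum using (_⊎_)
open import Relation.Binary.PropositionalEquality using (_≡_)

-- A partition (λ₁,…,λₙ) is represented by the list [λ₁, …, λₙ].
-- IsPart n k xs : xs ∈ 𝒫^{n,k}, i.e. exactly n parts, weakly decreasing,
-- all parts positive and ≤ k.
IsPart : ℕ → ℕ → List ℕ → Set
IsPart n k xs = (length xs ≡ n) × Linked _≥_ xs × All (λ x → 1 ≤ x × x ≤ k) xs

-- 1-indexed evaluation λ(i) = λᵢ (default 0 outside [n], never used there).
at : List ℕ → ℕ → ℕ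
at xs       zero          = 0
at []       (suc i)       = 0
at (x ∷ xs) (suc zero)    = x
at (x ∷ xs) (suc (suc i)) = at xs (suc i)

τ : ℕ → List ℕ → List ℕ
τ k xs = reverse (map (λ x → suc k ∸ x) xs)

dropLast : List ℕ → List ℕ
dropLast []           = []
dropLast (x ∷ [])     = []
dropLast (x ∷ y ∷ xs) = x ∷ dropLast (y ∷ xs)

IsSq : ℕ → List ℕ → Set
IsSq k lam = IsPart k k lam × at lam 1 ≡ k × at lam k ≡ 1

-- InP k lam d μ :  μ ∈ 𝒫^{k+d}(lam)   (defined by recursion on d = ℓ - k)
mutual
  InPd : ℕ → List ℕ → ℕ → List ℕ → Set
  InPd k lam d μ = IsPart (suc (k + d)) (suc (k + d)) μ × InP k lam d (dropLast μ)

  InP : ℕ → List ℕ → ℕ → List ℕ → Set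
  InP k lam zero    μ = μ ≡ lam ⊎ μ ≡ τ k lam
  InP k lam (suc d) μ =
    InPd k lam d μ ⊎ (∃[ ν ] (InPd k lam d ν × μ ≡ τ (suc (k + d)) ν))

InPℓ : ℕ → List ℕ → ℕ → List ℕ → Set
InPℓ k lam ℓ μ = InP k lam (ℓ ∸ k) μ

tildeLam : ℕ → ℕ → List ℕ → List ℤ
tildeLam k b μ = applyUpTo (λ j → ((+ at μ (b + j)) ℤ.- (+ b)) ℤ.+ (+ 1)) k

Cond : ℕ → List ℕ → ℕ → List ℕ → ℕ → Set
Cond k lam ℓ μ b =
  (at μ b ≡ b + k ∸ 1 × at μ (b + k ∸ 1) ≡ b)
  × (∀ i → 1 ≤ i → i < b → at μ (at μ i) > i)
  × (∀ i → b + k ∸ 1 < i → i ≤ ℓ → at μ (at μ i) < i)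
  × (tildeLam k b μ ≡ map +_ lam ⊎ tildeLam k b μ ≡ map +_ (τ k lam))

module Submission where

-- Write μ ∈ 𝒫^ℓ as a weakly decreasing function [ℓ] → [ℓ], let r(i) = ℓ + 1 - i
-- reverse [ℓ], and place a window [b0+1, b0+k] inside [ℓ], ℓ = b0 + k + e.  Then
-- τ_ℓ μ = r ∘ μ ∘ r, so (τ_ℓ μ)² = r ∘ μ² ∘ r, and two facts drive everything:
--   * Reflection: (i)–(iv) for μ with window [b0+1, b0+k] give (i)–(iv) for τ_ℓ μ
--     with the mirrored window [e+1, e+k]; (ii) and (iii) are exchanged and the
--     window λ̃ is replaced by τ_k λ̃.
--   * Dropping the last part: if μ ∈ 𝒫^{n+1} and μ(1) ≤ n, then μ ∖ {μ_{n+1}} ∈ 𝒫^n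
--     and (i)–(iv) for μ and for μ ∖ {μ_{n+1}} are equivalent (for windows inside [n]).
-- The theorem then follows by induction on d = ℓ - k, mirroring the inductive
-- definition of 𝒫^ℓ(λ).  In the converse direction, a μ with μ(1) = ℓ is handled
-- through τ_ℓ μ: (ii) at i = 1 or (iii) at i = ℓ forces μ(ℓ) ≥ 2, so (τ_ℓ μ)(1) < ℓ.

open import Defs
open import Data.Nat using (ℕ; zero; suc; _+_; _∸_; _≤_; _<_; _≥_; _>_; z≤n; s≤s; _≤?_)
open import Data.Nat.Properties
open import Data.Nat.Tactic.RingSolver using (solve)
open import Data.Integer as ℤ using (ℤ; +_)
import Data.Integer.Properties as ℤP
open import Data.Integer.Tactic.RingSolver using () renaming (solve-∀ to ℤ-solve-∀)
open import Data.List using (List; []; _∷_; length; map; reverse; applyUpTo; _++_)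
open import Data.List.Properties using (length-map; length-reverse; unfold-reverse; ∷-injective)
open import Data.List.Relation.Unary.All as All using (All)
open import Data.List.Relation.Unary.Linked as Linked using (Linked; [-])
open import Data.Product using (_×_; _,_; proj₁; proj₂; ∃-syntax)
open import Data.Sum using (_⊎_; inj₁; inj₂)
import Data.Sum as Sum
open import Data.Empty using (⊥; ⊥-elim)
open import Function.Bundles using (_⇔_; mk⇔)
import Function.Properties.Equivalence as ⇔
open import Relation.Binary.PropositionalEquality
open import Relation.Nullary using (¬_; yes; no)

open ≡-Reasoning

rv : ℕ → ℕ → ℕ
rv n i = suc n ∸ i

rv-≥1 : ∀ {n i} → i ≤ n → 1 ≤ rv n i
rv-≥1 i≤n = subst (1 ≤_) (sym (+-∸-assoc 1 i≤n)) (s≤s z≤n)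

rv-≤ : ∀ {n i} → 1 ≤ i → rv n i ≤ n
rv-≤ {n} 1≤i = ∸-monoʳ-≤ (suc n) 1≤i

rv-involutive : ∀ {n i} → i ≤ suc n → rv n (rv n i) ≡ i
rv-involutive = m∸[m∸n]≡n

rv-antitone : ∀ {n i j} → i ≤ j → rv n j ≤ rv n i
rv-antitone {n} = ∸-monoʳ-≤ (suc n)

rv-strict : ∀ {n i j} → i < j → j ≤ suc n → rv n j < rv n i
rv-strict = ∸-monoʳ-<

rv-complement : ∀ {n i} → i ≤ suc n → i + rv n i ≡ suc n
rv-complement = m+[n∸m]≡n

rv-solve : ∀ {n} x {y} → x + y ≡ suc n → rv n x ≡ y
rv-solve x {y} eq = subst (λ m → m ∸ x ≡ y) eq (m+n∸m≡n x y)

at-cons : ∀ x xs i → 1 ≤ i → at (x ∷ xs) (suc i) ≡ at xs i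
at-cons x xs (suc i) _ = refl

at-snoc : ∀ ys (x : ℕ) i → i ≤ length ys → at (ys ++ x ∷ []) i ≡ at ys i
at-snoc ys       x zero          _        = refl
at-snoc (y ∷ ys) x (suc zero)    _        = refl
at-snoc (y ∷ ys) x (suc (suc i)) (s≤s le) = at-snoc ys x (suc i) le

at-snoc-last : ∀ ys (x : ℕ) → at (ys ++ x ∷ []) (suc (length ys)) ≡ x
at-snoc-last []       x = refl
at-snoc-last (y ∷ ys) x = at-snoc-last ys x

at-reverse : ∀ xs i → 1 ≤ i → i ≤ length xs → at (reverse xs) i ≡ at xs (rv (length xs) i)
at-reverse []       (suc i) _ ()
at-reverse (x ∷ xs) i 1≤i i≤ rewrite unfold-reverse x xs with m≤n⇒m<n∨m≡n i≤
... | inj₁ (s≤s i≤l) = begin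
  at (reverse xs ++ x ∷ []) i  ≡⟨ at-snoc (reverse xs) x i (subst (i ≤_) (sym (length-reverse xs)) i≤l) ⟩
  at (reverse xs) i            ≡⟨ at-reverse xs i 1≤i i≤l ⟩
  at xs (rv (length xs) i)     ≡⟨ at-cons x xs _ (rv-≥1 i≤l) ⟨
  at (x ∷ xs) (suc (rv (length xs) i))  ≡⟨ cong (at (x ∷ xs)) (+-∸-assoc 1 (≤-trans i≤l (n≤1+n _))) ⟨
  at (x ∷ xs) (rv (suc (length xs)) i)  ∎
... | inj₂ refl = begin
  at (reverse xs ++ x ∷ []) (suc (length xs))           ≡⟨ cong (λ n → at (reverse xs ++ x ∷ []) (suc n)) (length-reverse xs) ⟨
  at (reverse xs ++ x ∷ []) (suc (length (reverse xs))) ≡⟨ at-snoc-last (reverse xs) x ⟩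
  x                                                     ≡⟨ cong (at (x ∷ xs)) (m+n∸n≡m 1 (length xs)) ⟨
  at (x ∷ xs) (rv (suc (length xs)) (suc (length xs)))  ∎

at-map : ∀ (f : ℕ → ℕ) xs i → 1 ≤ i → i ≤ length xs → at (map f xs) i ≡ f (at xs i)
at-map f (x ∷ xs) (suc zero)    _ _        = refl
at-map f (x ∷ xs) (suc (suc i)) _ (s≤s le) = at-map f xs (suc i) (s≤s z≤n) le

at-dropLast : ∀ xs i → i < length xs → at (dropLast xs) i ≡ at xs i
at-dropLast xs           zero          _        = refl
at-dropLast (x ∷ [])     (suc i)       (s≤s ())
at-dropLast (x ∷ y ∷ xs) (suc zero)    _        = refl
at-dropLast (x ∷ y ∷ xs) (suc (suc i)) (s≤s lt) = at-dropLast (y ∷ xs) (suc i) lt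

length-dropLast : ∀ xs → length (dropLast xs) ≡ length xs ∸ 1
length-dropLast []           = refl
length-dropLast (x ∷ [])     = refl
length-dropLast (x ∷ y ∷ xs) = cong suc (length-dropLast (y ∷ xs))

at-ext : ∀ xs ys → length xs ≡ length ys → (∀ i → 1 ≤ i → i ≤ length xs → at xs i ≡ at ys i) → xs ≡ ys
at-ext []       []       _  _ = refl
at-ext (x ∷ xs) (y ∷ ys) eq h = cong₂ _∷_ (h 1 ≤-refl (s≤s z≤n)) (at-ext xs ys (suc-injective eq) tail-agree)
  where
  tail-agree : ∀ i → 1 ≤ i → i ≤ length xs → at xs i ≡ at ys i
  tail-agree i 1≤i i≤ = begin
    at xs i             ≡⟨ at-cons x xs i 1≤i ⟨
    at (x ∷ xs) (suc i) ≡⟨ h (suc i) (s≤s z≤n) (s≤s i≤) ⟩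
    at (y ∷ ys) (suc i) ≡⟨ at-cons y ys i 1≤i ⟩
    at ys i             ∎

Decreasing : List ℕ → Set
Decreasing xs = ∀ i → 1 ≤ i → i < length xs → at xs (suc i) ≤ at xs i

PartsIn : ℕ → List ℕ → Set
PartsIn m xs = ∀ i → 1 ≤ i → i ≤ length xs → 1 ≤ at xs i × at xs i ≤ m

Partition : ℕ → ℕ → List ℕ → Set
Partition n m xs = length xs ≡ n × Decreasing xs × PartsIn m xs

linked→decreasing : ∀ {xs} → Linked _≥_ xs → Decreasing xs
linked→decreasing [-]         (suc zero) _ (s≤s ())
linked→decreasing (x≥y Linked.∷ _)   (suc zero) _ _ = x≥y
linked→decreasing (_ Linked.∷ links) (suc (suc i)) _ (s≤s lt) = linked→decreasing links (suc i) (s≤s z≤n) lt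

decreasing→linked : ∀ xs → Decreasing xs → Linked _≥_ xs
decreasing→linked []           _   = Linked.[]
decreasing→linked (x ∷ [])     _   = [-]
decreasing→linked (x ∷ y ∷ xs) dec =
  dec 1 ≤-refl (s≤s (s≤s z≤n)) Linked.∷ decreasing→linked (y ∷ xs) λ { (suc i) _ lt → dec (suc (suc i)) (s≤s z≤n) (s≤s lt) }

all→partsIn : ∀ {m xs} → All (λ x → 1 ≤ x × x ≤ m) xs → PartsIn m xs
all→partsIn (p All.∷ _)  (suc zero)    _ _        = p
all→partsIn (_ All.∷ ps) (suc (suc i)) _ (s≤s le) = all→partsIn ps (suc i) (s≤s z≤n) le

partsIn→all : ∀ {m} xs → PartsIn m xs → All (λ x → 1 ≤ x × x ≤ m) xs
partsIn→all []       _     = All.[]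
partsIn→all (x ∷ xs) parts =
  parts 1 ≤-refl (s≤s z≤n) All.∷ partsIn→all xs λ i 1≤i le →
    subst (λ z → 1 ≤ z × z ≤ _) (at-cons x xs i 1≤i) (parts (suc i) (s≤s z≤n) (s≤s le))

isPart→partition : ∀ {n m xs} → IsPart n m xs → Partition n m xs
isPart→partition (len , links , parts) = len , linked→decreasing links , all→partsIn parts

partition→isPart : ∀ {n m xs} → Partition n m xs → IsPart n m xs
partition→isPart {xs = xs} (len , dec , parts) = len , decreasing→linked xs dec , partsIn→all xs parts

part-bounds : ∀ {n m xs i} → Partition n m xs → 1 ≤ i → i ≤ n → 1 ≤ at xs i × at xs i ≤ m
part-bounds (refl , _ , parts) = parts _

part-antitone : ∀ {n m xs i j} → Partition n m xs → 1 ≤ i → i ≤ j → j ≤ n → at xs j ≤ at xs i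
part-antitone {j = zero}  _ (s≤s _) ()
part-antitone {j = suc j} p@(refl , dec , _) 1≤i i≤j j≤n with m≤n⇒m<n∨m≡n i≤j
... | inj₂ refl         = ≤-refl
... | inj₁ (s≤s i≤j′) =
  ≤-trans (dec j (≤-trans 1≤i i≤j′) j≤n) (part-antitone p 1≤i i≤j′ (≤-trans (n≤1+n j) j≤n))

length-τ : ∀ n xs → length (τ n xs) ≡ length xs
length-τ n xs = trans (length-reverse (map _ xs)) (length-map _ xs)

at-τ : ∀ n xs i → 1 ≤ i → i ≤ length xs → at (τ n xs) i ≡ rv n (at xs (rv (length xs) i))
at-τ n xs i 1≤i i≤ = begin
  at (reverse (map (rv n) xs)) i                    ≡⟨ at-reverse (map (rv n) xs) i 1≤i (subst (i ≤_) (sym (length-map _ xs)) i≤) ⟩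
  at (map (rv n) xs) (rv (length (map (rv n) xs)) i) ≡⟨ cong (λ l → at (map (rv n) xs) (rv l i)) (length-map _ xs) ⟩
  at (map (rv n) xs) (rv (length xs) i)             ≡⟨ at-map (rv n) xs _ (rv-≥1 i≤) (rv-≤ 1≤i) ⟩
  rv n (at xs (rv (length xs) i))                   ∎

τ-at : ∀ {n xs i} → Partition n n xs → 1 ≤ i → i ≤ n → at (τ n xs) i ≡ rv n (at xs (rv n i))
τ-at {xs = xs} (refl , _ , _) = at-τ (length xs) xs _

τ-partition : ∀ {n xs} → Partition n n xs → Partition n n (τ n xs)
τ-partition {n} {xs} p@(len , _ , _) = trans (length-τ n xs) len , decreasing , parts
  where
  len-τ : length (τ n xs) ≡ n
  len-τ = trans (length-τ n xs) len
  decreasing : Decreasing (τ n xs)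
  decreasing i 1≤i lt rewrite len-τ
                            | τ-at p 1≤i (≤-trans (n≤1+n i) lt)
                            | τ-at p (s≤s z≤n) lt =
    rv-antitone (part-antitone p (rv-≥1 lt) (rv-antitone (n≤1+n i)) (rv-≤ 1≤i))
  parts : PartsIn n (τ n xs)
  parts i 1≤i le rewrite len-τ | τ-at p 1≤i le =
    let (lo , hi) = part-bounds p (rv-≥1 le) (rv-≤ 1≤i) in rv-≥1 hi , rv-≤ lo

τ-involutive : ∀ {n xs} → Partition n n xs → τ n (τ n xs) ≡ xs
τ-involutive {n} {xs} p@(len , _ , _) =
  at-ext _ _ (trans (length-τ n (τ n xs)) (length-τ n xs)) λ i 1≤i le → entry i 1≤i (subst (i ≤_) lengths le)
  where
  lengths : length (τ n (τ n xs)) ≡ n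
  lengths = trans (length-τ n (τ n xs)) (trans (length-τ n xs) len)
  entry : ∀ i → 1 ≤ i → i ≤ n → at (τ n (τ n xs)) i ≡ at xs i
  entry i 1≤i i≤n = begin
    at (τ n (τ n xs)) i               ≡⟨ τ-at (τ-partition p) 1≤i i≤n ⟩
    rv n (at (τ n xs) (rv n i))       ≡⟨ cong (rv n) (τ-at p (rv-≥1 i≤n) (rv-≤ 1≤i)) ⟩
    rv n (rv n (at xs (rv n (rv n i)))) ≡⟨ cong (λ j → rv n (rv n (at xs j))) (rv-involutive (≤-trans i≤n (n≤1+n n))) ⟩
    rv n (rv n (at xs i))             ≡⟨ rv-involutive (≤-trans (proj₂ (part-bounds p 1≤i i≤n)) (n≤1+n n)) ⟩
    at xs i                           ∎

τ-square : ∀ {n μ i} → Partition n n μ → 1 ≤ i → i ≤ n →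
           at (τ n μ) (at (τ n μ) i) ≡ rv n (at μ (at μ (rv n i)))
τ-square {n} {μ} {i} p 1≤i i≤n = begin
  at (τ n μ) (at (τ n μ) i)              ≡⟨ cong (at (τ n μ)) (τ-at p 1≤i i≤n) ⟩
  at (τ n μ) (rv n x)                    ≡⟨ τ-at p (rv-≥1 x≤n) (rv-≤ 1≤x) ⟩
  rv n (at μ (rv n (rv n x)))            ≡⟨ cong (λ j → rv n (at μ j)) (rv-involutive (≤-trans x≤n (n≤1+n n))) ⟩
  rv n (at μ x)                          ∎
  where
  x = at μ (rv n i)
  bounds = part-bounds p (rv-≥1 i≤n) (rv-≤ {n} 1≤i)
  1≤x = proj₁ bounds
  x≤n = proj₂ bounds

-- Condition (iv) entrywise, in ℕ: the window of μ starting at b is L, that is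
-- μ(b + j) - b + 1 = L(j + 1) for 0 ≤ j < |L|.
WindowIs : List ℕ → ℕ → List ℕ → Set
WindowIs μ b L = ∀ j → j < length L → at μ (b + j) + 1 ≡ at L (suc j) + b

applyUpTo≡map→ : ∀ (g : ℕ → ℤ) L → applyUpTo g (length L) ≡ map +_ L →
                 ∀ j → j < length L → g j ≡ + at L (suc j)
applyUpTo≡map→ g (x ∷ L) eq zero    _        = proj₁ (∷-injective eq)
applyUpTo≡map→ g (x ∷ L) eq (suc j) (s≤s lt) = applyUpTo≡map→ (λ i → g (suc i)) L (proj₂ (∷-injective eq)) j lt

applyUpTo≡map← : ∀ (g : ℕ → ℤ) L → (∀ j → j < length L → g j ≡ + at L (suc j)) →
                 applyUpTo g (length L) ≡ map +_ L
applyUpTo≡map← g []      _ = refl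
applyUpTo≡map← g (x ∷ L) h =
  cong₂ _∷_ (h 0 (s≤s z≤n)) (applyUpTo≡map← (λ i → g (suc i)) L λ j lt → h (suc j) (s≤s lt))

applyUpTo-cong : ∀ {A : Set} (f g : ℕ → A) k → (∀ j → j < k → f j ≡ g j) → applyUpTo f k ≡ applyUpTo g k
applyUpTo-cong f g zero    _ = refl
applyUpTo-cong f g (suc k) h =
  cong₂ _∷_ (h 0 (s≤s z≤n)) (applyUpTo-cong (λ i → f (suc i)) (λ i → g (suc i)) k λ j lt → h (suc j) (s≤s lt))

entry→ : ∀ a b c → (+ a ℤ.- + b) ℤ.+ + 1 ≡ + c → a + 1 ≡ c + b
entry→ a b c eq = ℤP.+-injective (begin
  + (a + 1)                           ≡⟨ shift (+ a) (+ b) ⟩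
  ((+ a ℤ.- + b) ℤ.+ + 1) ℤ.+ + b     ≡⟨ cong (ℤ._+ + b) eq ⟩
  + c ℤ.+ + b                         ∎)
  where
  shift : ∀ (x y : ℤ) → x ℤ.+ + 1 ≡ ((x ℤ.- y) ℤ.+ + 1) ℤ.+ y
  shift = ℤ-solve-∀

entry← : ∀ a b c → a + 1 ≡ c + b → (+ a ℤ.- + b) ℤ.+ + 1 ≡ + c
entry← a b c eq = begin
  (+ a ℤ.- + b) ℤ.+ + 1     ≡⟨ shift (+ a) (+ b) ⟩
  (+ a ℤ.+ + 1) ℤ.- + b     ≡⟨ cong (ℤ._- + b) (cong +_ eq) ⟩
  (+ c ℤ.+ + b) ℤ.- + b     ≡⟨ cancel (+ c) (+ b) ⟩
  + c                       ∎
  where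
  shift : ∀ (x y : ℤ) → (x ℤ.- y) ℤ.+ + 1 ≡ (x ℤ.+ + 1) ℤ.- y
  shift = ℤ-solve-∀
  cancel : ∀ (z y : ℤ) → (z ℤ.+ y) ℤ.- y ≡ z
  cancel = ℤ-solve-∀

tildeLam→window : ∀ {k} b μ L → length L ≡ k → tildeLam k b μ ≡ map +_ L → WindowIs μ b L
tildeLam→window b μ L refl eq j lt = entry→ _ _ _ (applyUpTo≡map→ _ L eq j lt)

window→tildeLam : ∀ {k} b μ L → length L ≡ k → WindowIs μ b L → tildeLam k b μ ≡ map +_ L
window→tildeLam b μ L refl w = applyUpTo≡map← _ L λ j lt → entry← _ _ _ (w j lt)

tildeLam-cong : ∀ k b μ ν → (∀ j → j < k → at μ (b + j) ≡ at ν (b + j)) → tildeLam k b μ ≡ tildeLam k b ν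
tildeLam-cong k b μ ν agree =
  applyUpTo-cong _ _ k λ j lt → cong (λ x → (+ x ℤ.- + b) ℤ.+ + 1) (agree j lt)

WindowCond : ℕ → List ℕ → List ℕ → ℕ → Set
WindowCond k lam μ b = WindowIs μ b lam ⊎ WindowIs μ b (τ k lam)

iv→window : ∀ {k lam} μ b → length lam ≡ k →
            tildeLam k b μ ≡ map +_ lam ⊎ tildeLam k b μ ≡ map +_ (τ k lam) → WindowCond k lam μ b
iv→window {k} {lam} μ b len =
  Sum.map (tildeLam→window b μ lam len) (tildeLam→window b μ (τ k lam) (trans (length-τ k lam) len))

window→iv : ∀ {k lam} μ b → length lam ≡ k →
            WindowCond k lam μ b → tildeLam k b μ ≡ map +_ lam ⊎ tildeLam k b μ ≡ map +_ (τ k lam)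
window→iv {k} {lam} μ b len =
  Sum.map (window→tildeLam b μ lam len) (window→tildeLam b μ (τ k lam) (trans (length-τ k lam) len))

-- Arithmetic of windows.  With ℓ = b0 + k + e, the reflection of [1, ℓ] exchanges the
-- window [b0+1, b0+k] with the window [e+1, e+k], reversing the order of the entries.
window-swap : ∀ {b0 k e ℓ} → b0 + k + e ≡ ℓ → e + k + b0 ≡ ℓ
window-swap {b0} {k} {e} refl = solve (b0 ∷ k ∷ e ∷ [])

mirror-start : ∀ {b0 k e ℓ} → b0 + k + e ≡ ℓ → rv ℓ (suc e) ≡ b0 + k
mirror-start {b0} {k} {e} refl = rv-solve (suc e) (solve (b0 ∷ k ∷ e ∷ []))

mirror-end : ∀ {b0 k e ℓ} → b0 + k + e ≡ ℓ → rv ℓ (b0 + k) ≡ suc e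
mirror-end {b0} {k} {e} refl = rv-solve (b0 + k) (solve (b0 ∷ k ∷ e ∷ []))

mirror-entry : ∀ {b0 k0 e ℓ j j′} → b0 + suc k0 + e ≡ ℓ → j + j′ ≡ k0 → rv ℓ (suc e + j) ≡ suc b0 + j′
mirror-entry {b0} {e = e} {j = j} {j′} refl refl = rv-solve (suc e + j) (solve (b0 ∷ e ∷ j ∷ j′ ∷ []))

-- If m - b + 1 = c for the window at b = b0 + 1, then the reflected value x = ℓ + 1 - m
-- satisfies x - b′ + 1 = k + 1 - c for the mirrored window at b′ = e + 1.
mirror-value : ∀ {b0 k e ℓ m x c y} → b0 + k + e ≡ ℓ → m + x ≡ suc ℓ → c + y ≡ suc k →
               m + 1 ≡ c + suc b0 → x + 1 ≡ y + suc e
mirror-value {b0} {k} {e} {m = m} {x} {c} {y} refl mx cy window = +-cancelʳ-≡ (c + suc b0) (x + 1) (y + suc e) (begin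
  x + 1 + (c + suc b0)         ≡⟨ cong (λ t → x + 1 + t) window ⟨
  x + 1 + (m + 1)              ≡⟨ solve (x ∷ m ∷ []) ⟩
  m + x + 2                    ≡⟨ cong (_+ 2) mx ⟩
  suc (b0 + k + e) + 2         ≡⟨ solve (b0 ∷ k ∷ e ∷ []) ⟩
  suc k + suc e + suc b0       ≡⟨ cong (λ t → t + suc e + suc b0) cy ⟨
  c + y + suc e + suc b0       ≡⟨ solve (c ∷ y ∷ e ∷ b0 ∷ []) ⟩
  y + suc e + (c + suc b0)     ∎)

window-index : ∀ x {j k} → j < k → suc x + j ≤ x + k
window-index x {j} {k} j<k = subst (_≤ x + k) (+-suc x j) (+-monoʳ-≤ x j<k)

window-start : ∀ x k0 → suc x ≤ x + suc k0
window-start x k0 = subst (suc x ≤_) (sym (+-suc x k0)) (s≤s (m≤m+n x k0))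

-- If μ ∈ 𝒫^ℓ satisfies (i)–(iv) with the window
-- starting at b0 + 1, then ν = τ_ℓ μ satisfies them with the window starting at e + 1:
-- ν² = r ∘ μ² ∘ r turns "μ² decreases above the window" into "ν² increases below the
-- mirrored window" and vice versa, and the window of ν is τ_k of the window of μ.
module Reflection {k0 b0 e ℓ : ℕ} (split : b0 + suc k0 + e ≡ ℓ) {lam μ : List ℕ}
                  (plam : Partition (suc k0) (suc k0) lam) (pμ : Partition ℓ ℓ μ) where
  k : ℕ
  k = suc k0

  ν : List ℕ
  ν = τ ℓ μ

  b0+k≤ℓ : b0 + k ≤ ℓ
  b0+k≤ℓ = subst (b0 + k ≤_) split (m≤m+n (b0 + k) e)

  e+k≤ℓ : e + k ≤ ℓ
  e+k≤ℓ = subst (e + k ≤_) (window-swap {b0} {k} {e} split) (m≤m+n (e + k) b0)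

  rv-suc-e : rv ℓ (suc e) ≡ b0 + k
  rv-suc-e = mirror-start {b0} {k} {e} split
  rv-b0+k : rv ℓ (b0 + k) ≡ suc e
  rv-b0+k = mirror-end {b0} {k} {e} split
  rv-suc-b0 : rv ℓ (suc b0) ≡ e + k
  rv-suc-b0 = mirror-start {e} {k} {b0} (window-swap {b0} {k} {e} split)
  rv-e+k : rv ℓ (e + k) ≡ suc b0
  rv-e+k = mirror-end {e} {k} {b0} (window-swap {b0} {k} {e} split)

  square-≤ : ∀ {i} → 1 ≤ i → i ≤ ℓ → at μ (at μ i) ≤ suc ℓ
  square-≤ 1≤i i≤ℓ =
    let (lo , hi) = part-bounds pμ 1≤i i≤ℓ in ≤-trans (proj₂ (part-bounds pμ lo hi)) (n≤1+n ℓ)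

  reflect-i : at μ (suc b0) ≡ b0 + k → at μ (b0 + k) ≡ suc b0 →
              at ν (suc e) ≡ e + k × at ν (e + k) ≡ suc e
  reflect-i start end = ν-start , ν-end
    where
    ν-start : at ν (suc e) ≡ e + k
    ν-start = begin
      at ν (suc e)                ≡⟨ τ-at pμ (s≤s z≤n) (≤-trans (window-start e k0) e+k≤ℓ) ⟩
      rv ℓ (at μ (rv ℓ (suc e)))  ≡⟨ cong (λ i → rv ℓ (at μ i)) rv-suc-e ⟩
      rv ℓ (at μ (b0 + k))        ≡⟨ cong (rv ℓ) end ⟩
      rv ℓ (suc b0)               ≡⟨ rv-suc-b0 ⟩
      e + k                       ∎
    ν-end : at ν (e + k) ≡ suc e
    ν-end = begin
      at ν (e + k)                ≡⟨ τ-at pμ (≤-trans (s≤s z≤n) (window-start e k0)) e+k≤ℓ ⟩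
      rv ℓ (at μ (rv ℓ (e + k)))  ≡⟨ cong (λ i → rv ℓ (at μ i)) rv-e+k ⟩
      rv ℓ (at μ (suc b0))        ≡⟨ cong (rv ℓ) start ⟩
      rv ℓ (b0 + k)               ≡⟨ rv-b0+k ⟩
      suc e                       ∎

  reflect-ii : (∀ i → b0 + k < i → i ≤ ℓ → at μ (at μ i) < i) →
               ∀ i → 1 ≤ i → i < suc e → at ν (at ν i) > i
  reflect-ii iii i 1≤i (s≤s i≤e) =
    subst (i <_) (sym (τ-square pμ 1≤i i≤ℓ))
      (subst (_< rv ℓ (at μ (at μ (rv ℓ i)))) (rv-involutive (≤-trans i≤ℓ (n≤1+n ℓ)))
        (rv-strict (iii (rv ℓ i) above (rv-≤ 1≤i)) (≤-trans (rv-≤ {ℓ} 1≤i) (n≤1+n ℓ))))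
    where
    suc-e≤ℓ : suc e ≤ ℓ
    suc-e≤ℓ = ≤-trans (window-start e k0) e+k≤ℓ
    i≤ℓ : i ≤ ℓ
    i≤ℓ = ≤-trans (n≤1+n i) (≤-trans (s≤s i≤e) suc-e≤ℓ)
    above : b0 + k < rv ℓ i
    above = subst (_< rv ℓ i) rv-suc-e (rv-strict (s≤s i≤e) (≤-trans suc-e≤ℓ (n≤1+n ℓ)))

  reflect-iii : (∀ i → 1 ≤ i → i < suc b0 → at μ (at μ i) > i) →
                ∀ i → e + k < i → i ≤ ℓ → at ν (at ν i) < i
  reflect-iii ii i e+k<i i≤ℓ =
    subst (_< i) (sym (τ-square pμ 1≤i i≤ℓ))
      (subst (rv ℓ (at μ (at μ (rv ℓ i))) <_) (rv-involutive (≤-trans i≤ℓ (n≤1+n ℓ)))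
        (rv-strict (ii (rv ℓ i) (rv-≥1 i≤ℓ) below) (square-≤ (rv-≥1 i≤ℓ) (rv-≤ 1≤i))))
    where
    1≤i : 1 ≤ i
    1≤i = ≤-trans (s≤s z≤n) e+k<i
    below : rv ℓ i < suc b0
    below = subst (rv ℓ i <_) rv-e+k (rv-strict e+k<i (≤-trans i≤ℓ (n≤1+n ℓ)))

  reflect-window : ∀ L → Partition k k L → WindowIs μ (suc b0) L → WindowIs ν (suc e) (τ k L)
  reflect-window L pL window j j<|τL| = begin
    at ν (suc e + j) + 1        ≡⟨ cong (_+ 1) ν-entry ⟩
    rv ℓ m + 1                  ≡⟨ mirror-value {b0} {k} {e} split (rv-complement m≤) (rv-complement c≤) (window j′ j′<|L|) ⟩
    rv k c + suc e              ≡⟨ cong (_+ suc e) τL-entry ⟨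
    at (τ k L) (suc j) + suc e  ∎
    where
    j<k : j < k
    j<k = subst (j <_) (trans (length-τ k L) (proj₁ pL)) j<|τL|
    j′ : ℕ
    j′ = k0 ∸ j
    j+j′ : j + j′ ≡ k0
    j+j′ = m+[n∸m]≡n (≤-pred j<k)
    j′<k : j′ < k
    j′<k = s≤s (m∸n≤m k0 j)
    j′<|L| : j′ < length L
    j′<|L| = subst (j′ <_) (sym (proj₁ pL)) j′<k
    m c : ℕ
    m = at μ (suc b0 + j′)
    c = at L (suc j′)
    m≤ : m ≤ suc ℓ
    m≤ = ≤-trans (proj₂ (part-bounds pμ (s≤s z≤n) (≤-trans (window-index b0 j′<k) b0+k≤ℓ))) (n≤1+n ℓ)
    c≤ : c ≤ suc k
    c≤ = ≤-trans (proj₂ (part-bounds pL (s≤s z≤n) j′<k)) (n≤1+n k)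
    ν-entry : at ν (suc e + j) ≡ rv ℓ m
    ν-entry = trans (τ-at pμ (s≤s z≤n) (≤-trans (window-index e j<k) e+k≤ℓ))
                    (cong (λ i → rv ℓ (at μ i)) (mirror-entry {b0} {k0} {e} {j = j} {j′} split j+j′))
    τL-entry : at (τ k L) (suc j) ≡ rv k c
    τL-entry = trans (τ-at pL (s≤s z≤n) j<k) (cong (λ i → rv k (at L i)) (mirror-entry {0} {k0} {0} {j = j} {j′} (+-identityʳ k) j+j′))

  reflect-iv : WindowCond k lam μ (suc b0) → WindowCond k lam ν (suc e)
  reflect-iv (inj₁ window) = inj₂ (reflect-window lam plam window)
  reflect-iv (inj₂ window) = inj₁ (subst (WindowIs ν (suc e)) (τ-involutive plam)
                                     (reflect-window (τ k lam) (τ-partition plam) window))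

  reflect : Cond k lam ℓ μ (suc b0) → Cond k lam ℓ ν (suc e)
  reflect ((start , end) , ii , iii , iv) =
    reflect-i start end , reflect-ii iii , reflect-iii ii ,
    window→iv ν (suc e) (proj₁ plam) (reflect-iv (iv→window μ (suc b0) (proj₁ plam) iv))

Admissible : ℕ → List ℕ → ℕ → List ℕ → Set
Admissible k lam ℓ μ = ∃[ b0 ] ∃[ e ] (b0 + k + e ≡ ℓ × Cond k lam ℓ μ (suc b0))

reflect-admissible : ∀ {k0 ℓ lam μ} → Partition (suc k0) (suc k0) lam → Partition ℓ ℓ μ →
                     Admissible (suc k0) lam ℓ μ → Admissible (suc k0) lam ℓ (τ ℓ μ)
reflect-admissible {k0} plam pμ (b0 , e , split , c) =
  e , b0 , window-swap {b0} {suc k0} {e} split , Reflection.reflect split plam pμ c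

-- If μ ∈ 𝒫^{n+1} has μ(1) ≤ n, every value of μ lies in [1, n],
-- so μ′ = μ ∖ {μ_{n+1}} lies in 𝒫^n and agrees with μ, and μ′² with μ², on [1, n].
-- For a window inside [1, n], conditions (i)–(iv) for μ and for μ′ are the same: the
-- only extra instance, (iii) at i = n + 1, holds since μ²(n+1) ≤ n.
module DropLast {n : ℕ} {μ : List ℕ} (pμ : Partition (suc n) (suc n) μ) (top : at μ 1 ≤ n) where
  μ′ : List ℕ
  μ′ = dropLast μ

  agree : ∀ {i} → i ≤ n → at μ′ i ≡ at μ i
  agree {i} i≤n = at-dropLast μ i (subst (i <_) (sym (proj₁ pμ)) (s≤s i≤n))

  values : ∀ {i} → 1 ≤ i → i ≤ suc n → 1 ≤ at μ i × at μ i ≤ n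
  values 1≤i i≤ = proj₁ (part-bounds pμ 1≤i i≤) , ≤-trans (part-antitone pμ ≤-refl 1≤i i≤) top

  agree² : ∀ {i} → 1 ≤ i → i ≤ n → at μ′ (at μ′ i) ≡ at μ (at μ i)
  agree² 1≤i i≤n = trans (cong (at μ′) (agree i≤n)) (agree (proj₂ (values 1≤i (≤-trans i≤n (n≤1+n n)))))

  partition : Partition n n μ′
  partition = len , decreasing , parts
    where
    len : length μ′ ≡ n
    len = trans (length-dropLast μ) (cong (_∸ 1) (proj₁ pμ))
    decreasing : Decreasing μ′
    decreasing i 1≤i lt =
      let i<n = subst (i <_) len lt in
      subst₂ _≤_ (sym (agree i<n)) (sym (agree (≤-trans (n≤1+n i) i<n)))
        (proj₁ (proj₂ pμ) i 1≤i (subst (i <_) (sym (proj₁ pμ)) (≤-trans i<n (n≤1+n n))))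
    parts : PartsIn n μ′
    parts i 1≤i le =
      let i≤n = subst (i ≤_) len le in
      subst (λ x → 1 ≤ x × x ≤ n) (sym (agree i≤n)) (values 1≤i (≤-trans i≤n (n≤1+n n)))

  module _ {k0 b0 e : ℕ} {lam : List ℕ} (split : b0 + suc k0 + e ≡ n) where
    b0+k≤n : b0 + suc k0 ≤ n
    b0+k≤n = subst (b0 + suc k0 ≤_) split (m≤m+n (b0 + suc k0) e)

    suc-b0≤n : suc b0 ≤ n
    suc-b0≤n = ≤-trans (window-start b0 k0) b0+k≤n

    below-window : ∀ {i} → i < suc b0 → i ≤ n
    below-window i<b = ≤-trans (≤-pred i<b) (≤-trans (n≤1+n b0) suc-b0≤n)

    window-agree : tildeLam (suc k0) (suc b0) μ′ ≡ tildeLam (suc k0) (suc b0) μ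
    window-agree = tildeLam-cong (suc k0) (suc b0) μ′ μ λ j j<k → agree (≤-trans (window-index b0 j<k) b0+k≤n)

    shrink : Cond (suc k0) lam (suc n) μ (suc b0) → Cond (suc k0) lam n μ′ (suc b0)
    shrink ((start , end) , ii , iii , iv) =
      (trans (agree suc-b0≤n) start , trans (agree b0+k≤n) end)
      , (λ i 1≤i i<b → subst (i <_) (sym (agree² 1≤i (below-window i<b))) (ii i 1≤i i<b))
      , (λ i above i≤n → subst (_< i) (sym (agree² (≤-trans (s≤s z≤n) above) i≤n))
                                   (iii i above (≤-trans i≤n (n≤1+n n))))
      , Sum.map (trans window-agree) (trans window-agree) iv

    extend : Cond (suc k0) lam n μ′ (suc b0) → Cond (suc k0) lam (suc n) μ (suc b0)
    extend ((start , end) , ii , iii , iv) =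
      (trans (sym (agree suc-b0≤n)) start , trans (sym (agree b0+k≤n)) end)
      , (λ i 1≤i i<b → subst (i <_) (agree² 1≤i (below-window i<b)) (ii i 1≤i i<b))
      , iii-extended
      , Sum.map (trans (sym window-agree)) (trans (sym window-agree)) iv
      where
      iii-extended : ∀ i → b0 + suc k0 < i → i ≤ suc n → at μ (at μ i) < i
      iii-extended i above i≤ with m≤n⇒m<n∨m≡n i≤
      ... | inj₁ (s≤s i≤n) = subst (_< i) (agree² (≤-trans (s≤s z≤n) above) i≤n) (iii i above i≤n)
      ... | inj₂ refl      = let (lo , hi) = values (s≤s z≤n) ≤-refl in
                             s≤s (proj₂ (values lo (≤-trans hi (n≤1+n n))))

  -- A window reaching position n + 1 is impossible, since μ(b0 + 1) ≤ μ(1) ≤ n; so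
  -- admissibility of μ and μ′ coincide.
  shrink-admissible : ∀ {k0 lam} → Admissible (suc k0) lam (suc n) μ → Admissible (suc k0) lam n μ′
  shrink-admissible {k0} (b0 , zero , split , c) =
    ⊥-elim (1+n≰n (subst (_≤ n) (trans start (trans (sym (+-identityʳ _)) split)) (proj₂ (values (s≤s z≤n) suc-b0≤))))
    where
    start : at μ (suc b0) ≡ b0 + suc k0
    start = proj₁ (proj₁ c)
    suc-b0≤ : suc b0 ≤ suc n
    suc-b0≤ = ≤-trans (window-start b0 k0) (≤-reflexive (trans (sym (+-identityʳ _)) split))
  shrink-admissible {k0} (b0 , suc e , split , c) = b0 , e , split′ , shrink split′ c
    where
    split′ : b0 + suc k0 + e ≡ n
    split′ = suc-injective (trans (sym (+-suc _ e)) split)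

  extend-admissible : ∀ {k0 lam} → Admissible (suc k0) lam n μ′ → Admissible (suc k0) lam (suc n) μ
  extend-admissible (b0 , e , split , c) = b0 , suc e , trans (+-suc _ e) (cong suc split) , extend split c

-- If μ ∈ 𝒫^ℓ is admissible, ℓ > k and μ(1) = ℓ, then μ(ℓ) ≥ 2.  Otherwise μ²(1) = 1
-- contradicts (ii) at i = 1 when the window does not start at 1, and μ²(ℓ) = ℓ
-- contradicts (iii) at i = ℓ when it does (it then ends at k < ℓ).
smallest-part-≥2 : ∀ {k lam ℓ μ} → k < ℓ → Partition ℓ ℓ μ → Admissible k lam ℓ μ →
                   at μ 1 ≡ ℓ → 2 ≤ at μ ℓ
smallest-part-≥2 {k} {lam} {ℓ} {μ} k<ℓ pμ adm first with at μ ℓ ≤? 1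
... | no  ≰1 = ≰⇒> ≰1
... | yes ≤1 = ⊥-elim (no-window adm (≤-antisym ≤1 (proj₁ (part-bounds pμ (≤-trans (s≤s z≤n) k<ℓ) ≤-refl))))
  where
  no-window : Admissible k lam ℓ μ → at μ ℓ ≡ 1 → ⊥
  no-window (zero , _ , _ , _ , _ , iii , _) last = <-irrefl (trans (cong (at μ) last) first) (iii ℓ k<ℓ ≤-refl)
  no-window (suc _ , _ , _ , _ , ii , _ , _) last =
    <-irrefl (sym (trans (cong (at μ) first) last)) (ii 1 ≤-refl (s≤s (s≤s z≤n)))

whole-window : ∀ {μ L} → length μ ≡ length L → WindowIs μ 1 L → μ ≡ L
whole-window {μ} {L} len window =
  at-ext μ L len λ { (suc j) _ j<μ → +-cancelʳ-≡ 1 _ _ (window j (subst (suc j ≤_) len j<μ)) }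

whole-window-start : ∀ {b0 k e} → b0 + k + e ≡ k → b0 ≡ 0
whole-window-start {b0} {k} {e} split =
  n≤0⇒n≡0 (+-cancelʳ-≤ k b0 0 (subst (b0 + k ≤_) split (m≤m+n (b0 + k) e)))

position→split : ∀ {k ℓ} {P : ℕ → Set} → k ≤ ℓ →
                 ∃[ b ] (1 ≤ b × b ≤ ℓ ∸ k + 1 × P b) → ∃[ b0 ] ∃[ e ] (b0 + k + e ≡ ℓ × P (suc b0))
position→split {k} {ℓ} k≤ℓ (suc b0 , _ , b≤ , p) = b0 , ℓ ∸ k ∸ b0 , split , p
  where
  b0≤ : b0 ≤ ℓ ∸ k
  b0≤ = ≤-pred (subst (suc b0 ≤_) (+-comm (ℓ ∸ k) 1) b≤)
  split : b0 + k + (ℓ ∸ k ∸ b0) ≡ ℓ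
  split = begin
    b0 + k + (ℓ ∸ k ∸ b0)    ≡⟨ cong (_+ (ℓ ∸ k ∸ b0)) (+-comm b0 k) ⟩
    k + b0 + (ℓ ∸ k ∸ b0)    ≡⟨ +-assoc k b0 (ℓ ∸ k ∸ b0) ⟩
    k + (b0 + (ℓ ∸ k ∸ b0))  ≡⟨ cong (λ t → k + t) (m+[n∸m]≡n b0≤) ⟩
    k + (ℓ ∸ k)              ≡⟨ m+[n∸m]≡n k≤ℓ ⟩
    ℓ                        ∎

split→position : ∀ {k ℓ} {P : ℕ → Set} →
                 ∃[ b0 ] ∃[ e ] (b0 + k + e ≡ ℓ × P (suc b0)) → ∃[ b ] (1 ≤ b × b ≤ ℓ ∸ k + 1 × P b)
split→position {k} (b0 , e , refl , p) = suc b0 , s≤s z≤n , bound , p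
  where
  rest : b0 + k + e ∸ k ≡ b0 + e
  rest = trans (cong (_∸ k) (reorder b0 k e)) (m+n∸n≡m (b0 + e) k)
    where
    reorder : ∀ b0 k e → b0 + k + e ≡ b0 + e + k
    reorder b0 k e = solve (b0 ∷ k ∷ e ∷ [])
  bound : suc b0 ≤ b0 + k + e ∸ k + 1
  bound = subst (λ t → suc b0 ≤ t + 1) (sym rest) (subst (suc b0 ≤_) (+-comm 1 (b0 + e)) (s≤s (m≤m+n b0 e)))

window-position : ∀ {k ℓ} (P : ℕ → Set) → k ≤ ℓ →
                  (∃[ b ] (1 ≤ b × b ≤ ℓ ∸ k + 1 × P b)) ⇔ (∃[ b0 ] ∃[ e ] (b0 + k + e ≡ ℓ × P (suc b0)))
window-position P k≤ℓ = mk⇔ (position→split k≤ℓ) split→position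

module Induction (k0 : ℕ) (lam : List ℕ) (plam : Partition (suc k0) (suc k0) lam)
                 (first : at lam 1 ≡ suc k0) (last : at lam (suc k0) ≡ 1) where
  k : ℕ
  k = suc k0

  Good : ℕ → List ℕ → Set
  Good ℓ μ = Partition ℓ ℓ μ × Admissible k lam ℓ μ

  cast : ∀ {ℓ ℓ′ μ} → ℓ ≡ ℓ′ → Good ℓ μ → Good ℓ′ μ
  cast {μ = μ} = subst (λ ℓ → Good ℓ μ)

  τ-good : ∀ {ℓ μ} → Good ℓ μ → Good ℓ (τ ℓ μ)
  τ-good (pμ , adm) = τ-partition pμ , reflect-admissible plam pμ adm

  -- λ is good with the window [1, k]: (i) says λ ∈ 𝒫^k_sq and (ii), (iii) are vacuous.
  lam-good : Good k lam
  lam-good =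
    plam , 0 , 0 , +-identityʳ k , (first , last)
    , (λ i 1≤i i<1 → ⊥-elim (<⇒≱ i<1 1≤i))
    , (λ i k<i i≤k → ⊥-elim (<⇒≱ k<i i≤k))
    , inj₁ (window→tildeLam 1 lam lam (proj₁ plam) λ j _ → refl)

  base-sound : ∀ {μ} → InP k lam 0 μ → Good k μ
  base-sound (inj₁ refl) = lam-good
  base-sound (inj₂ refl) = τ-good lam-good

  base-complete : ∀ {μ} → Good k μ → InP k lam 0 μ
  base-complete {μ} (pμ , b0 , e , split , c) with whole-window-start {b0} {k} {e} split
  ... | refl = Sum.map (whole-window (trans (proj₁ pμ) (sym (proj₁ plam))))
                       (whole-window (trans (proj₁ pμ) (sym (trans (length-τ k lam) (proj₁ plam)))))
                       (iv→window μ 1 (proj₁ plam) (proj₂ (proj₂ (proj₂ c))))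

  extend-good : ∀ {n μ} → 1 ≤ n → IsPart (suc n) (suc n) μ → Good n (dropLast μ) → Good (suc n) μ
  extend-good {n} {μ} 1≤n ip (p′ , adm′) = pμ , DropLast.extend-admissible pμ top adm′
    where
    pμ : Partition (suc n) (suc n) μ
    pμ = isPart→partition ip
    top : at μ 1 ≤ n
    top = subst (_≤ n) (at-dropLast μ 1 (subst (1 <_) (sym (proj₁ pμ)) (s≤s 1≤n)))
                (proj₂ (part-bounds p′ ≤-refl 1≤n))

  sound : ∀ d {μ} → InP k lam d μ → Good (k + d) μ
  sound zero    m                        = cast (sym (+-identityʳ k)) (base-sound m)
  sound (suc d) (inj₁ (ip , m))          = cast (sym (+-suc k d)) (extend-good (s≤s z≤n) ip (sound d m))
  sound (suc d) (inj₂ (ν , (ip , m) , refl)) =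
    cast (sym (+-suc k d)) (τ-good (extend-good (s≤s z≤n) ip (sound d m)))

  descend : ∀ d {μ} → (∀ {ν} → Good (k + d) ν → InP k lam d ν) →
            Good (suc (k + d)) μ → at μ 1 ≤ k + d → InPd k lam d μ
  descend d complete-d (pμ , adm) top =
    partition→isPart pμ , complete-d (DropLast.partition pμ top , DropLast.shrink-admissible pμ top adm)

  -- If a good μ has μ(1) = ℓ, then (τ_ℓ μ)(1) = ℓ + 1 - μ(ℓ) ≤ ℓ - 1.
  reflected-top : ∀ d {μ} → Good (suc (k + d)) μ → ¬ (at μ 1 ≤ k + d) → at (τ (suc (k + d)) μ) 1 ≤ k + d
  reflected-top d {μ} (pμ , adm) ≰top =
    subst (_≤ k + d) (sym (τ-at pμ ≤-refl (s≤s z≤n))) (rv-antitone (smallest-part-≥2 (s≤s (m≤m+n k d)) pμ adm first-part))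
    where
    first-part : at μ 1 ≡ suc (k + d)
    first-part = ≤-antisym (proj₂ (part-bounds pμ (s≤s z≤n) (s≤s z≤n))) (≰⇒> ≰top)

  complete-step : ∀ d {μ} → (∀ {ν} → Good (k + d) ν → InP k lam d ν) → Good (suc (k + d)) μ → InP k lam (suc d) μ
  complete-step d {μ} complete-d good with at μ 1 ≤? k + d
  ... | yes top  = inj₁ (descend d complete-d good top)
  ... | no ≰top  = inj₂ (τ (suc (k + d)) μ , descend d complete-d (τ-good good) (reflected-top d good ≰top)
                          , sym (τ-involutive (proj₁ good)))

  complete : ∀ d {μ} → Good (k + d) μ → InP k lam d μ
  complete zero    good = base-complete (cast (+-identityʳ k) good)
  complete (suc d) good = complete-step d (complete d) (cast (+-suc k d) good)

  characterisation : ∀ d {ℓ μ} → k + d ≡ ℓ → Partition ℓ ℓ μ → InP k lam d μ ⇔ Admissible k lam ℓ μ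
  characterisation d refl pμ = mk⇔ (λ m → proj₂ (sound d m)) (λ adm → complete d (pμ , adm))

mainTheorem1 : (k ℓ : ℕ) → 1 ≤ k → k ≤ ℓ → (lam μ : List ℕ) →
    IsSq k lam → IsPart ℓ ℓ μ →
    InPℓ k lam ℓ μ ⇔ (∃[ b ] (1 ≤ b × b ≤ ℓ ∸ k + 1 × Cond k lam ℓ μ b))
mainTheorem1 (suc k0) ℓ (s≤s z≤n) k≤ℓ lam μ (ipl , first , last) ipμ =
  ⇔.trans (Induction.characterisation k0 lam (isPart→partition ipl) first last
             (ℓ ∸ suc k0) (m+[n∸m]≡n k≤ℓ) (isPart→partition ipμ))
          (⇔.sym (window-position (Cond (suc k0) lam ℓ μ) k≤ℓ))
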